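{- Let $\mathbb{F}$ be a field. Then $\mathrm{PER}\leq_{abp} ID^*$.
   Context: Noncommutative polynomials over $\mathbb{F}$ in variables $\{x_{ij}:1\le i,j\le n\}$. The noncommutative permanent is $\mathrm{PER}_n=\sum_{\sigma\in S_n}x_{1\sigma(1)}x_{2\sigma(2)}\cdots x_{n\sigma(n)}$, and $\mathrm{PER}=(\mathrm{PER}_n)$. Let $W_n$ be the set of all degree-$n$ monomials of the form $x_{1,i_1}x_{2,i_2}\cdots x_{n,i_n}$ with $i_1,\ldots,i_n\in[n]$, and $ID^*_n=\sum_{w\in W_n} w^{n^2}$ (the word $w$ repeated $n^2$ times); $ID^*=(ID^*_n)$. For p-families $f=(f_n)$, $f_n\in\mathbb{F}\langle X_n\rangle$, and $g=(g_n)$, $g_n\in\mathbb{F}\langle Y_n\rangle$, $f\leq_{abp} g$ means there are polynomials $p(n),q(n)$ and maps $\phi$ sending each variable of $Y_{p(n)}$ to a $q(n)\times q(n)$ matrix with entries field elements or variables of $X_n$ (the paper also allows constant-degree monomials over $X_n$), such that $f_n$ is the $(1,q(n))$ entry of $g_{p(n)}(\phi(Y_{p(n)}))$. -}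

module Defs where

open import Level using (Level; _⊔_) renaming (suc to lsuc)
open import Algebra.Bundles using (CommutativeRing)
open import Data.Nat using (ℕ; zero; suc) renaming (_+_ to _+ℕ_; _*_ to _*ℕ_)
open import Data.Fin using (Fin; fromℕ) renaming (zero to fzero; _≟_ to _≟ᶠ_)
open import Data.List using (List; []; _∷_; _++_; concat; concatMap; map; foldr; allFin; filter; zip; replicate; upTo)
open import Data.Product using (Σ; ∃; _×_; _,_)
open import Data.Product.Properties as ×P using ()
open import Data.List.Properties as LP using ()
open import Relation.Nullary using (¬_; yes; no; Dec)
open import Relation.Binary.PropositionalEquality using (_≡_)
open import Relation.Binary.Definitions using (DecidableEquality)
import Data.List.Relation.Unary.Unique.DecPropositional as UDec

record Field (c ℓ : Level) : Set (lsuc (c ⊔ ℓ)) where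
  field
    commutativeRing : CommutativeRing c ℓ
  open CommutativeRing commutativeRing public
  field
    0≉1     : ¬ (0# ≈ 1#)
    inverse : ∀ x → ¬ (x ≈ 0#) → ∃ λ y → x * y ≈ 1#

-- Polynomials p(n) with natural-number coefficients, as coefficient lists
-- [a₀, a₁, …] ↦ a₀ + a₁ n + a₂ n² + …

evalℕPoly : List ℕ → ℕ → ℕ
evalℕPoly []       n = 0
evalℕPoly (a ∷ as) n = a +ℕ n *ℕ evalℕPoly as n

-- The variables x_{ij}, 1 ≤ i,j ≤ n  (indices 0-based in Fin n)

Var : ℕ → Set
Var n = Fin n × Fin n

_≟ᵛ_ : ∀ {n} → DecidableEquality (Var n)
_≟ᵛ_ = ×P.≡-dec _≟ᶠ_ _≟ᶠ_

_≟ʷ_ : ∀ {n} → DecidableEquality (List (Var n))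
_≟ʷ_ = LP.≡-dec _≟ᵛ_

module NCPoly {c ℓ} (F : Field c ℓ) where
  open Field F

  -- A noncommutative polynomial over F in variables V, given as a formal
  -- (finite) sum of terms  coefficient · word.
  NCP : Set → Set c
  NCP V = List (Carrier × List V)

  coeff : ∀ {n} → NCP (Var n) → List (Var n) → Carrier
  coeff []            u = 0#
  coeff ((a , w) ∷ p) u with w ≟ʷ u
  ... | yes _ = a + coeff p u
  ... | no  _ = coeff p u

  _≈ₚ_ : ∀ {n} → NCP (Var n) → NCP (Var n) → Set ℓ
  p ≈ₚ q = ∀ u → coeff p u ≈ coeff q u

  _+ₚ_ : ∀ {V} → NCP V → NCP V → NCP V
  p +ₚ q = p ++ q

  _*ₚ_ : ∀ {V} → NCP V → NCP V → NCP V
  p *ₚ q = concatMap (λ { (a , v) → map (λ { (b , w) → (a * b , v ++ w) }) q }) p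

  scaleₚ : ∀ {V} → Carrier → NCP V → NCP V
  scaleₚ a p = map (λ { (b , w) → (a * b , w) }) p

  oneₚ : ∀ {V} → NCP V
  oneₚ = (1# , []) ∷ []

  sumₚ : ∀ {V} → List (NCP V) → NCP V
  sumₚ = concat

  Family : Set c
  Family = (n : ℕ) → NCP (Var n)

  data Entry (n : ℕ) : Set c where
    const : Carrier → Entry n
    var   : Var n → Entry n

  entryₚ : ∀ {n} → Entry n → NCP (Var n)
  entryₚ (const a) = (a , []) ∷ []
  entryₚ (var x)   = (1# , x ∷ []) ∷ []

  Mat : ℕ → Set → Set c
  Mat q V = Fin q → Fin q → NCP V

  idM : ∀ {q V} → Mat q V
  idM i j with i ≟ᶠ j
  ... | yes _ = oneₚ
  ... | no  _ = []

  _*M_ : ∀ {q V} → Mat q V → Mat q V → Mat q V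
  (A *M B) i j = sumₚ (map (λ k → A i k *ₚ B k j) (allFin _))

  _+M_ : ∀ {q V} → Mat q V → Mat q V → Mat q V
  (A +M B) i j = A i j +ₚ B i j

  scaleM : ∀ {q V} → Carrier → Mat q V → Mat q V
  scaleM a A i j = scaleₚ a (A i j)

  zeroM : ∀ {q V} → Mat q V
  zeroM i j = []

  substM : ∀ {m q n} → NCP (Var m) → (Var m → Fin q → Fin q → Entry n) → Mat q (Var n)
  substM g φ = foldr (λ { (a , w) acc →
                  scaleM a (foldr (λ y M → (λ i j → entryₚ (φ y i j)) *M M) idM w) +M acc })
               zeroM g

  _≤abp_ : Family → Family → Set (c ⊔ ℓ)
  f ≤abp g =
    Σ (List ℕ) λ ps → Σ (List ℕ) λ qs → (n : ℕ) →
      Σ (Var (evalℕPoly ps n) → Fin (suc (evalℕPoly qs n)) → Fin (suc (evalℕPoly qs n)) → Entry n) λ φ →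
        f n ≈ₚ substM (g (evalℕPoly ps n)) φ fzero (fromℕ (evalℕPoly qs n))

  tuples : (n k : ℕ) → List (List (Fin n))
  tuples n zero    = [] ∷ []
  tuples n (suc k) = concatMap (λ i → map (i ∷_) (tuples n k)) (allFin n)

  rowWord : ∀ {n} → List (Fin n) → List (Var n)
  rowWord {n} is = zip (allFin n) is

  Wn : (n : ℕ) → List (List (Var n))
  Wn n = map rowWord (tuples n n)

  -- PER_n = Σ_{σ ∈ S_n} x_{1σ(1)} ⋯ x_{nσ(n)}; σ ranges over the
  -- injective maps [n] → [n], i.e. the tuples (σ(1),…,σ(n)) with distinct entries
  PER : Family
  PER n = map (λ is → (1# , rowWord is)) (filter (UDec.unique? _≟ᶠ_) (tuples n n))

  pow : ∀ {V : Set} → List V → ℕ → List V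
  pow w k = concat (replicate k w)

  IDstar : Family
  IDstar n = map (λ w → (1# , pow w (n *ℕ n))) (Wn n)

-- A word w = x_{1,i₁} ⋯ x_{n,iₙ} of W_n is fed n² times to a deterministic transducer with n² + 1
-- states. It spends the r-th copy of w in phase r: it records the column i_r, fails if a later
-- row repeats it, and outputs just the letter x_{r,i_r}; after n phases it idles in a final state.
-- So the run on w^{n²} outputs w when i is injective and fails otherwise. Substituting for each
-- variable its transition matrix (entry (s, s′) is the letter output on the transition s → s′,
-- 1 if nothing is output, 0 if there is no such transition) makes the (start, final) entry of the
-- product over a word the output of the run on it; summing over W_n yields PER_n.

module Submission where

open import Defs
open import Level using (Level)
open import Data.Bool using (Bool; true; false; _∧_; if_then_else_)
open import Data.Empty using (⊥-elim)
open import Data.Fin as Fin using (Fin; zero; suc; toℕ; fromℕ; fromℕ<; inject₁; combine; remQuot; _≟_)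
open import Data.Fin.Properties using (toℕ<n; fromℕ<-toℕ; remQuot-combine)
import Data.Fin.Properties as FinP
open import Data.Fin.Relation.Unary.Top using (View; view; ‵fromℕ; ‵inj₁; view-fromℕ; view-inject₁)
open import Data.List using (List; []; _∷_; _++_; [_]; concat; map; foldr; filter; replicate; tabulate; allFin; length; zip; fromMaybe)
open import Data.List.Properties using (++-assoc; length-++; length-tabulate; map-tabulate; map-cong; map-∘; ∷-injectiveˡ; ∷-injectiveʳ)
open import Data.List.Relation.Unary.All as All using (All; []; _∷_; all?)
import Data.List.Relation.Unary.All.Properties as All
import Data.List.Relation.Unary.Unique.DecPropositional as Unique
open import Data.Maybe as Maybe using (Maybe; just; nothing; _>>=_)
import Data.Maybe.Properties as Maybe
open import Data.Nat using (ℕ; zero; suc)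
import Data.Nat as Nat
import Data.Nat.Properties as NatP
open import Data.Product using (Σ; _×_; _,_; proj₁; proj₂; uncurry)
open import Function using (_∘_; id)
open import Relation.Binary using (Setoid; tri<; tri≈; tri>)
import Relation.Binary.Reasoning.Setoid as SetoidReasoning
open import Relation.Binary.PropositionalEquality using (_≡_; _≢_; refl; sym; trans; cong; cong₂; subst; module ≡-Reasoning)
open import Relation.Nullary using (Dec; yes; no; does; ¬?)
open import Relation.Nullary.Decidable using (dec-true; dec-false)

n*n≡n+pred[n]*n : ∀ n → n Nat.* n ≡ n Nat.+ Nat.pred n Nat.* n
n*n≡n+pred[n]*n zero    = refl
n*n≡n+pred[n]*n (suc n) = refl

map-proj₂-zip : ∀ {a b} {A : Set a} {B : Set b} (xs : List A) (ys : List B) →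
                length ys ≡ length xs → map proj₂ (zip xs ys) ≡ ys
map-proj₂-zip []       []       _   = refl
map-proj₂-zip (x ∷ xs) (y ∷ ys) len = cong (y ∷_) (map-proj₂-zip xs ys (NatP.suc-injective len))

guard : ∀ {a} {A : Set a} → Bool → Maybe A → Maybe A
guard true  x = x
guard false _ = nothing

module _ {a b} {A : Set a} {B : Set b} where

  map-guard : ∀ (f : A → B) t x → Maybe.map f (guard t x) ≡ guard t (Maybe.map f x)
  map-guard f true  x = refl
  map-guard f false x = refl

  guard->>= : ∀ t x (f : A → Maybe B) → (guard t x >>= f) ≡ guard t (x >>= f)
  guard->>= true  x f = refl
  guard->>= false x f = refl

guard-∧ : ∀ {a} {A : Set a} b b′ (x : Maybe A) → guard (b ∧ b′) x ≡ guard b (guard b′ x)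
guard-∧ true  b′ x = refl
guard-∧ false b′ x = refl

module _ {a b} {A : Set a} {B : Set b} (f : A → B) {p} {P : A → Set p} (P? : ∀ x → Dec (P x)) where

  map-filter-∷ : ∀ x xs →
                 map f (filter P? (x ∷ xs)) ≡ (if does (P? x) then f x ∷ [] else []) ++ map f (filter P? xs)
  map-filter-∷ x xs with does (P? x)
  ... | true  = refl
  ... | false = refl

module Transducer {X Y S : Set} (δ : Y → S → Maybe (S × Maybe X)) where

  prefix : List X → S × List X → S × List X
  prefix o (s , o′) = s , o ++ o′

  mutual
    run : List Y → S → Maybe (S × List X)
    run []      s = just (s , [])
    run (y ∷ w) s = continue (δ y s) w

    continue : Maybe (S × Maybe X) → List Y → Maybe (S × List X)
    continue nothing        w = nothing
    continue (just (s , e)) w = Maybe.map (prefix (fromMaybe e)) (run w s)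

  resume : List Y → S × List X → Maybe (S × List X)
  resume w (s , o) = Maybe.map (prefix o) (run w s)

  map-prefix->>= : ∀ o x w → Maybe.map (prefix o) (x >>= resume w) ≡ (Maybe.map (prefix o) x >>= resume w)
  map-prefix->>= o nothing         w = refl
  map-prefix->>= o (just (s , o′)) w = begin
    Maybe.map (prefix o) (Maybe.map (prefix o′) (run w s)) ≡⟨ Maybe.map-∘ (run w s) ⟨
    Maybe.map (prefix o ∘ prefix o′) (run w s)            ≡⟨ Maybe.map-cong prefix-++ (run w s) ⟩
    Maybe.map (prefix (o ++ o′)) (run w s)                ∎
    where
    open ≡-Reasoning
    prefix-++ : ∀ t → prefix o (prefix o′ t) ≡ prefix (o ++ o′) t
    prefix-++ (s , o″) = cong (s ,_) (sym (++-assoc o o′ o″))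

  run-++ : ∀ v w s → run (v ++ w) s ≡ (run v s >>= resume w)
  run-++ []      w s = sym (Maybe.map-id (run w s))
  run-++ (y ∷ v) w s with δ y s
  ... | nothing       = refl
  ... | just (s′ , e) = trans (cong (Maybe.map (prefix (fromMaybe e))) (run-++ v w s′))
                              (map-prefix->>= (fromMaybe e) (run v s′) w)

module PermutationCheck (n : ℕ) where

  open Nat using (pred; _+_; _*_; _<_; _<?_)
  open NatP using (suc-injective; <-cmp; <-irrefl; <-trans; ≤-<-trans; <⇒≢; m<m+n; n<1+n; +-suc; +-comm; +-identityʳ)

  data State : Set where
    done  : State
    phase : (r m : Fin n) → State

  -- The stored column m of a fresh phase r is a placeholder: it is overwritten on row r before it is
  -- compared with anything.
  enter : ℕ → State
  enter r with r <? n
  ... | yes r<n = phase (fromℕ< r<n) (fromℕ< r<n)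
  ... | no  _   = done

  next : (k r m : Fin n) → State
  next k r m = if does (suc (toℕ k) Nat.≟ n) then enter (suc (toℕ r)) else phase r m

  δ : Var n → State → Maybe (State × Maybe (Var n))
  δ _       done        = just (done , nothing)
  δ (k , c) (phase r m) with <-cmp (toℕ k) (toℕ r)
  ... | tri< _ _ _ = just (next k r m , nothing)
  ... | tri≈ _ _ _ = just (next k r c , just (k , c))
  ... | tri> _ _ _ = if does (m ≟ c) then nothing else just (next k r m , nothing)

  open Transducer δ public

  cols : List (Var n) → List (Fin n)
  cols = map proj₂

  distinctFrom : Fin n → List (Fin n) → Bool
  distinctFrom m cs = does (all? (λ c → ¬? (m ≟ c)) cs)

  unique : List (Fin n) → Bool
  unique cs = does (Unique.unique? _≟_ cs)

  RowsFrom : ℕ → List (Var n) → Set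
  RowsFrom o []            = o ≡ n
  RowsFrom o ((k , _) ∷ L) = toℕ k ≡ o × RowsFrom (suc o) L

  RowsFrom-length : ∀ {o} L → RowsFrom o L → o + length L ≡ n
  RowsFrom-length {o} []      o≡n        = trans (+-identityʳ o) o≡n
  RowsFrom-length {o} (_ ∷ L) (_ , rows) = trans (+-suc o (length L)) (RowsFrom-length L rows)

  RowsFrom-++ : ∀ {o} u {v} → RowsFrom o (u ++ v) → RowsFrom (o + length u) v
  RowsFrom-++ {o} []      {v} rows       = subst (λ o′ → RowsFrom o′ v) (sym (+-identityʳ o)) rows
  RowsFrom-++ {o} (_ ∷ u) {v} (_ , rows) = subst (λ o′ → RowsFrom o′ v) (sym (+-suc o (length u))) (RowsFrom-++ u rows)

  RowsFrom-< : ∀ {o} y L → RowsFrom o (y ∷ L) → o < n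
  RowsFrom-< (k , _) _ (refl , _) = toℕ<n k

  RowsFrom-allFin : ∀ cs → length cs ≡ n → RowsFrom 0 (zip (allFin n) cs)
  RowsFrom-allFin cs len = go id 0 (λ _ → refl) cs refl len
    where
    go : ∀ {l} (f : Fin l → Fin n) o → (∀ i → toℕ (f i) ≡ o + toℕ i) →
         ∀ cs → o + l ≡ n → length cs ≡ l → RowsFrom o (zip (tabulate f) cs)
    go {zero}  f o hf []       o+0≡n refl = trans (sym (+-identityʳ o)) o+0≡n
    go {suc l} f o hf (c ∷ cs) o+l≡n len  =
      trans (hf zero) (+-identityʳ o) , go (f ∘ suc) (suc o) (λ i → trans (hf (suc i)) (+-suc o (toℕ i))) cs
                   (trans (sym (+-suc o l)) o+l≡n) (suc-injective len)

  enter-toℕ : ∀ k → enter (toℕ k) ≡ phase k k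
  enter-toℕ k with toℕ k <? n
  ... | yes k<n = cong₂ phase (fromℕ<-toℕ k k<n) (fromℕ<-toℕ k k<n)
  ... | no  k≮n = ⊥-elim (k≮n (toℕ<n k))

  enter-n : enter n ≡ done
  enter-n with n <? n
  ... | yes n<n = ⊥-elim (<-irrefl refl n<n)
  ... | no  _   = refl

  module _ {k r m : Fin n} where

    next-enter : suc (toℕ k) ≡ n → next k r m ≡ enter (suc (toℕ r))
    next-enter last rewrite dec-true (suc (toℕ k) Nat.≟ n) last = refl

    next-phase : suc (toℕ k) ≢ n → next k r m ≡ phase r m
    next-phase ¬last rewrite dec-false (suc (toℕ k) Nat.≟ n) ¬last = refl

  module _ {k : Fin n} {c : Fin n} where

    δ-before : ∀ {r m} → toℕ k < toℕ r → δ (k , c) (phase r m) ≡ just (phase r m , nothing)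
    δ-before {r} k<r with <-cmp (toℕ k) (toℕ r)
    ... | tri< _ _ _  = cong (λ s → just (s , nothing)) (next-phase (<⇒≢ (≤-<-trans k<r (toℕ<n r))))
    ... | tri≈ k≮r _ _ = ⊥-elim (k≮r k<r)
    ... | tri> k≮r _ _ = ⊥-elim (k≮r k<r)

    δ-at : ∀ {m} → δ (k , c) (phase k m) ≡ just (next k k c , just (k , c))
    δ-at with <-cmp (toℕ k) (toℕ k)
    ... | tri< k<k _ _ = ⊥-elim (<-irrefl refl k<k)
    ... | tri≈ _ _ _   = refl
    ... | tri> _ _ k>k = ⊥-elim (<-irrefl refl k>k)

    δ-after : ∀ {r m} → toℕ r < toℕ k →
              δ (k , c) (phase r m) ≡ (if does (m ≟ c) then nothing else just (next k r m , nothing))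
    δ-after {r} r<k with <-cmp (toℕ k) (toℕ r)
    ... | tri< _ _ r≮k  = ⊥-elim (r≮k r<k)
    ... | tri≈ _ _ r≮k  = ⊥-elim (r≮k r<k)
    ... | tri> _ _ _    = refl

  run-done : ∀ w → run w done ≡ just (done , [])
  run-done []      = refl
  run-done (_ ∷ w) = cong (Maybe.map id) (run-done w)

  run-before : ∀ u {o v r m} → RowsFrom o (u ++ v) → o + length u ≡ toℕ r →
               run (u ++ v) (phase r m) ≡ run v (phase r m)
  run-before []            _            _    = refl
  run-before ((k , c) ∷ u) {o} {v} {r} {m} (refl , rows) o+u≡r
    rewrite δ-before {k} {c} {r} {m} (subst (toℕ k <_) o+u≡r (m<m+n (toℕ k) Nat.z<s)) = begin
      Maybe.map id (run (u ++ v) (phase r m)) ≡⟨ Maybe.map-id _ ⟩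
      run (u ++ v) (phase r m)                ≡⟨ run-before u rows (trans (sym (+-suc (toℕ k) (length u))) o+u≡r) ⟩
      run v (phase r m)                       ∎
    where open ≡-Reasoning

  run-after : ∀ {o r m} y v → toℕ r < o → RowsFrom o (y ∷ v) →
              run (y ∷ v) (phase r m) ≡ guard (distinctFrom m (cols (y ∷ v))) (just (enter (suc (toℕ r)) , []))
  run-after {r = r} {m} (k , c) v r<k (refl , rows) rewrite δ-after {k} {c} {r} {m} r<k with does (m ≟ c)
  ... | true  = refl
  ... | false = continue-after v rows
    where
    continue-after : ∀ v → RowsFrom (suc (toℕ k)) v →
                     Maybe.map id (run v (next k r m)) ≡ guard (distinctFrom m (cols v)) (just (enter (suc (toℕ r)) , []))
    continue-after []       last = cong (λ s → just (s , [])) (next-enter last)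
    continue-after (y ∷ v′) rows rewrite next-phase {k} {r} {m} (<⇒≢ (RowsFrom-< y v′ rows)) =
      trans (Maybe.map-id _) (run-after y v′ (<-trans r<k (n<1+n _)) rows)

  run-at : ∀ {o k c m} v → RowsFrom o ((k , c) ∷ v) →
           run ((k , c) ∷ v) (phase k m) ≡ guard (distinctFrom c (cols v)) (just (enter (suc (toℕ k)) , [ k , c ]))
  run-at {k = k} {c} {m} v (refl , rows) rewrite δ-at {k} {c} {m} with v
  ... | []     = cong (λ s → just (s , [ k , c ])) (next-enter rows)
  ... | y ∷ v′ rewrite next-phase {k} {k} {c} (<⇒≢ (RowsFrom-< y v′ rows)) = begin
      Maybe.map (prefix [ k , c ]) (run (y ∷ v′) (phase k c))
        ≡⟨ cong (Maybe.map (prefix [ k , c ])) (run-after y v′ (n<1+n _) rows) ⟩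
      Maybe.map (prefix [ k , c ]) (guard (distinctFrom c (cols (y ∷ v′))) (just (enter (suc (toℕ k)) , [])))
        ≡⟨ map-guard (prefix [ k , c ]) (distinctFrom c (cols (y ∷ v′))) (just (enter (suc (toℕ k)) , [])) ⟩
      guard (distinctFrom c (cols (y ∷ v′))) (just (enter (suc (toℕ k)) , [ k , c ])) ∎
    where open ≡-Reasoning

  module _ {w : List (Var n)} (w-rows : RowsFrom 0 w) where

    private
      rows-after : ∀ u {v} → u ++ v ≡ w → RowsFrom (length u) v
      rows-after u u++v≡w = RowsFrom-++ u (subst (RowsFrom 0) (sym u++v≡w) w-rows)

    run-copy : ∀ u {k c} v m → u ++ (k , c) ∷ v ≡ w →
               run w (phase k m) ≡ guard (distinctFrom c (cols v)) (just (enter (suc (toℕ k)) , [ k , c ]))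
    run-copy u {k} {c} v m u++v≡w = begin
      run w (phase k m)                  ≡⟨ cong (λ w′ → run w′ (phase k m)) (sym u++v≡w) ⟩
      run (u ++ (k , c) ∷ v) (phase k m) ≡⟨ run-before u (subst (RowsFrom 0) (sym u++v≡w) w-rows) (sym (proj₁ rows)) ⟩
      run ((k , c) ∷ v) (phase k m)      ≡⟨ run-at v rows ⟩
      guard (distinctFrom c (cols v)) (just (enter (suc (toℕ k)) , [ k , c ])) ∎
      where
      open ≡-Reasoning
      rows = rows-after u u++v≡w

    run-phases : ∀ u v j → u ++ v ≡ w →
                 run (concat (replicate (length v + j) w)) (enter (length u)) ≡ guard (unique (cols v)) (just (done , v))
    run-phases u [] j u≡w = begin
      run rest (enter (length u)) ≡⟨ cong (run rest) (trans (cong enter (rows-after u u≡w)) enter-n) ⟩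
      run rest done               ≡⟨ run-done rest ⟩
      just (done , [])            ∎
      where
      open ≡-Reasoning
      rest = concat (replicate j w)
    run-phases u ((k , c) ∷ v) j u++v≡w = begin
      run (concat (replicate (suc (length v + j)) w)) (enter (length u))
        ≡⟨ cong (run (w ++ rest)) (trans (cong enter (sym k≡u)) (enter-toℕ k)) ⟩
      run (w ++ rest) (phase k k)
        ≡⟨ run-++ w rest (phase k k) ⟩
      (run w (phase k k) >>= resume rest)
        ≡⟨ cong (_>>= resume rest) (run-copy u v k u++v≡w) ⟩
      (guard D (just (enter (suc (toℕ k)) , [ k , c ])) >>= resume rest)
        ≡⟨ guard->>= D (just (enter (suc (toℕ k)) , [ k , c ])) (resume rest) ⟩
      guard D (Maybe.map (prefix [ k , c ]) (run rest (enter (suc (toℕ k)))))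
        ≡⟨ cong (λ s → guard D (Maybe.map (prefix [ k , c ]) (run rest (enter s)))) suc-k≡u′ ⟩
      guard D (Maybe.map (prefix [ k , c ]) (run rest (enter (length (u ++ [ k , c ])))))
        ≡⟨ cong (guard D ∘ Maybe.map (prefix [ k , c ]))
                (run-phases (u ++ [ k , c ]) v j (trans (++-assoc u [ k , c ] v) u++v≡w)) ⟩
      guard D (Maybe.map (prefix [ k , c ]) (guard U (just (done , v))))
        ≡⟨ cong (guard D) (map-guard (prefix [ k , c ]) U (just (done , v))) ⟩
      guard D (guard U (just (done , (k , c) ∷ v)))
        ≡⟨ guard-∧ D U (just (done , (k , c) ∷ v)) ⟨
      guard (unique (c ∷ cols v)) (just (done , (k , c) ∷ v)) ∎
      where
      open ≡-Reasoning
      rest = concat (replicate (length v + j) w)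
      D = distinctFrom c (cols v)
      U = unique (cols v)
      k≡u : toℕ k ≡ length u
      k≡u = proj₁ (rows-after u u++v≡w)
      suc-k≡u′ : suc (toℕ k) ≡ length (u ++ [ k , c ])
      suc-k≡u′ = trans (cong suc k≡u) (trans (+-comm 1 (length u)) (sym (length-++ u)))

    run-accepts : run (concat (replicate (n * n) w)) (enter 0) ≡ guard (unique (cols w)) (just (done , w))
    run-accepts = subst (λ l → run (concat (replicate l w)) (enter 0) ≡ guard (unique (cols w)) (just (done , w)))
                        (sym n*n≡w+l) (run-phases [] w (pred n * n) refl)
      where
      n*n≡w+l : n * n ≡ length w + pred n * n
      n*n≡w+l = trans (n*n≡n+pred[n]*n n) (cong (_+ pred n * n) (sym (RowsFrom-length w w-rows)))

  decodeView : ∀ {i : Fin (suc (n * n))} → View i → State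
  decodeView ‵fromℕ             = done
  decodeView (‵inj₁ {i = i} _) = uncurry phase (remQuot n i)

  encode : State → Fin (suc (n * n))
  encode done        = fromℕ (n * n)
  encode (phase r m) = inject₁ (combine r m)

  decode : Fin (suc (n * n)) → State
  decode i = decodeView (view i)

  decode-encode : ∀ s → decode (encode s) ≡ s
  decode-encode done        = cong decodeView (view-fromℕ (n * n))
  decode-encode (phase r m) = trans (cong decodeView (view-inject₁ (combine r m))) (cong (uncurry phase) (remQuot-combine r m))

encode-enter-0 : ∀ n → PermutationCheck.encode n (PermutationCheck.enter n 0) ≡ zero
encode-enter-0 zero    = refl
encode-enter-0 (suc n) = refl

module Coefficients {c ℓ} (F : Field c ℓ) {n : ℕ} where

  open Field F using (_≈_; _+_; _*_; 0#; 1#; +-cong; +-congˡ; +-congʳ; *-congˡ; +-assoc;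
                      +-identityˡ; +-identityʳ; *-identityˡ; zeroˡ; zeroʳ; distribˡ; setoid)
  open NCPoly F
  open Setoid setoid using () renaming (refl to ≈-refl; sym to ≈-sym; trans to ≈-trans)

  Poly : Set c
  Poly = NCP (Var n)

  -- _≈ₚ_ wrapped in a record, so that unification can recover the two polynomials from a proof.
  infix 4 _≋_
  record _≋_ (p q : Poly) : Set ℓ where
    constructor coeffwise
    field coeff-≈ : p ≈ₚ q
  open _≋_ public

  ≋-setoid : Setoid c ℓ
  ≋-setoid = record
    { Carrier       = Poly
    ; _≈_           = _≋_
    ; isEquivalence = record
      { refl  = coeffwise λ _ → ≈-refl
      ; sym   = λ p≋q → coeffwise λ u → ≈-sym (coeff-≈ p≋q u)
      ; trans = λ p≋q q≋r → coeffwise λ u → ≈-trans (coeff-≈ p≋q u) (coeff-≈ q≋r u)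
      }
    }

  open Setoid ≋-setoid public using () renaming (refl to ≋-refl; sym to ≋-sym; trans to ≋-trans)

  coeff-++ : ∀ (p q : Poly) u → coeff (p ++ q) u ≈ coeff p u + coeff q u
  coeff-++ []            q u = ≈-sym (+-identityˡ _)
  coeff-++ ((a , w) ∷ p) q u with w ≟ʷ u
  ... | yes _ = ≈-trans (+-congˡ (coeff-++ p q u)) (≈-sym (+-assoc _ _ _))
  ... | no  _ = coeff-++ p q u

  ++-cong : ∀ {p p′ q q′ : Poly} → p ≋ p′ → q ≋ q′ → p ++ q ≋ p′ ++ q′
  ++-cong {p} {p′} {q} {q′} p≋p′ q≋q′ = coeffwise λ u → begin
    coeff (p ++ q) u          ≈⟨ coeff-++ p q u ⟩
    coeff p u + coeff q u     ≈⟨ +-cong (coeff-≈ p≋p′ u) (coeff-≈ q≋q′ u) ⟩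
    coeff p′ u + coeff q′ u   ≈⟨ coeff-++ p′ q′ u ⟨
    coeff (p′ ++ q′) u        ∎
    where open SetoidReasoning setoid

  ++-identityʳ : ∀ (p : Poly) → p ++ [] ≋ p
  ++-identityʳ p = coeffwise λ u → ≈-trans (coeff-++ p [] u) (+-identityʳ _)

  coeff-scaleₚ : ∀ a (p : Poly) u → coeff (scaleₚ a p) u ≈ a * coeff p u
  coeff-scaleₚ a []            u = ≈-sym (zeroʳ a)
  coeff-scaleₚ a ((b , w) ∷ p) u with w ≟ʷ u
  ... | yes _ = ≈-trans (+-congˡ (coeff-scaleₚ a p u)) (≈-sym (distribˡ a b _))
  ... | no  _ = coeff-scaleₚ a p u

  scaleₚ-identity : ∀ (p : Poly) → scaleₚ 1# p ≋ p
  scaleₚ-identity p = coeffwise λ u → ≈-trans (coeff-scaleₚ 1# p u) (*-identityˡ _)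

  scaleₚ-zero : ∀ (p : Poly) → scaleₚ 0# p ≋ []
  scaleₚ-zero p = coeffwise λ u → ≈-trans (coeff-scaleₚ 0# p u) (zeroˡ _)

  scaleₚ-cong : ∀ a {p q : Poly} → p ≋ q → scaleₚ a p ≋ scaleₚ a q
  scaleₚ-cong a {p} {q} p≋q = coeffwise λ u →
    ≈-trans (coeff-scaleₚ a p u) (≈-trans (*-congˡ (coeff-≈ p≋q u)) (≈-sym (coeff-scaleₚ a q u)))

  term-cong : ∀ {a b} (w : List (Var n)) → a ≈ b → (a , w) ∷ [] ≋ (b , w) ∷ []
  term-cong {a} {b} w a≈b = coeffwise helper
    where
    helper : ∀ u → coeff ((a , w) ∷ []) u ≈ coeff ((b , w) ∷ []) u
    helper u with w ≟ʷ u
    ... | yes _ = +-congʳ a≈b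
    ... | no  _ = ≈-refl

  prependₚ : Var n → Poly → Poly
  prependₚ x = map (λ (b , w) → b , x ∷ w)

  coeff-prependₚ-∷ : ∀ x (p : Poly) u → coeff (prependₚ x p) (x ∷ u) ≈ coeff p u
  coeff-prependₚ-∷ x []            u = ≈-refl
  coeff-prependₚ-∷ x ((b , w) ∷ p) u with w ≟ʷ u | (x ∷ w) ≟ʷ (x ∷ u)
  ... | yes _   | yes _ = +-congˡ (coeff-prependₚ-∷ x p u)
  ... | no  _   | no  _ = coeff-prependₚ-∷ x p u
  ... | yes w≡u | no  ≢ = ⊥-elim (≢ (cong (x ∷_) w≡u))
  ... | no  w≢u | yes ≡ = ⊥-elim (w≢u (∷-injectiveʳ ≡))

  coeff-prependₚ-other : ∀ x (p : Poly) u → (∀ u′ → u ≢ x ∷ u′) → coeff (prependₚ x p) u ≈ 0#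
  coeff-prependₚ-other x []            u _      = ≈-refl
  coeff-prependₚ-other x ((b , w) ∷ p) u u≢x∷ with (x ∷ w) ≟ʷ u
  ... | yes x∷w≡u = ⊥-elim (u≢x∷ w (sym x∷w≡u))
  ... | no  _     = coeff-prependₚ-other x p u u≢x∷

  prependₚ-cong : ∀ x {p q : Poly} → p ≋ q → prependₚ x p ≋ prependₚ x q
  prependₚ-cong x {p} {q} p≋q = coeffwise helper
    where
    other : ∀ p u → (∀ u′ → u ≢ x ∷ u′) → coeff (prependₚ x p) u ≈ coeff (prependₚ x q) u
    other p u ≢ = ≈-trans (coeff-prependₚ-other x p u ≢) (≈-sym (coeff-prependₚ-other x q u ≢))
    helper : ∀ u → coeff (prependₚ x p) u ≈ coeff (prependₚ x q) u
    helper []      = other p [] λ _ ()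
    helper (z ∷ u) with z ≟ᵛ x
    ... | yes refl = ≈-trans (coeff-prependₚ-∷ x p u) (≈-trans (coeff-≈ p≋q u) (≈-sym (coeff-prependₚ-∷ x q u)))
    ... | no  z≢x  = other p (z ∷ u) λ _ z∷u≡x∷u′ → z≢x (∷-injectiveˡ z∷u≡x∷u′)

  const-*ₚ : ∀ a (p : Poly) → (entryₚ (const a) *ₚ p) ≡ scaleₚ a p ++ []
  const-*ₚ a p = cong (_++ []) (map-cong (λ _ → refl) p)

  var-*ₚ : ∀ x (p : Poly) → (entryₚ (var x) *ₚ p) ≡ scaleₚ 1# (prependₚ x p) ++ []
  var-*ₚ x p = cong (_++ []) (trans (map-cong (λ _ → refl) p) (map-∘ p))

  module ≋-Reasoning = SetoidReasoning ≋-setoid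

  entry-*ₚ-cong : ∀ (e : Entry n) {p q : Poly} → p ≋ q → (entryₚ e *ₚ p) ≋ (entryₚ e *ₚ q)
  entry-*ₚ-cong (const a) {p} {q} p≋q = begin
    entryₚ (const a) *ₚ p ≡⟨ const-*ₚ a p ⟩
    scaleₚ a p ++ []      ≈⟨ ++-cong (scaleₚ-cong a p≋q) ≋-refl ⟩
    scaleₚ a q ++ []      ≡⟨ const-*ₚ a q ⟨
    entryₚ (const a) *ₚ q ∎
    where open ≋-Reasoning
  entry-*ₚ-cong (var x) {p} {q} p≋q = begin
    entryₚ (var x) *ₚ p            ≡⟨ var-*ₚ x p ⟩
    scaleₚ 1# (prependₚ x p) ++ [] ≈⟨ ++-cong (scaleₚ-cong 1# (prependₚ-cong x p≋q)) ≋-refl ⟩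
    scaleₚ 1# (prependₚ x q) ++ [] ≡⟨ var-*ₚ x q ⟨
    entryₚ (var x) *ₚ q            ∎
    where open ≋-Reasoning

  zero-*ₚ : ∀ (p : Poly) → (entryₚ (const 0#) *ₚ p) ≋ []
  zero-*ₚ p = begin
    entryₚ (const 0#) *ₚ p ≡⟨ const-*ₚ 0# p ⟩
    scaleₚ 0# p ++ []      ≈⟨ ++-identityʳ (scaleₚ 0# p) ⟩
    scaleₚ 0# p            ≈⟨ scaleₚ-zero p ⟩
    []                     ∎
    where open ≋-Reasoning

  sum-zero : ∀ {q} (f : Fin q → Poly) → (∀ k → f k ≋ []) → concat (tabulate f) ≋ []
  sum-zero {zero}  f f≋0 = ≋-refl
  sum-zero {suc q} f f≋0 = ++-cong (f≋0 zero) (sum-zero (f ∘ suc) (f≋0 ∘ suc))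

  sum-single : ∀ {q} (f : Fin q → Poly) k₀ → (∀ k → k ≢ k₀ → f k ≋ []) → concat (tabulate f) ≋ f k₀
  sum-single {suc q} f zero     f≋0 =
    ≋-trans (++-cong ≋-refl (sum-zero (f ∘ suc) (λ k → f≋0 (suc k) λ ()))) (++-identityʳ (f zero))
  sum-single {suc q} f (suc k₀) f≋0 =
    ++-cong (f≋0 zero λ ()) (sum-single (f ∘ suc) k₀ λ k k≢k₀ → f≋0 (suc k) (k≢k₀ ∘ FinP.suc-injective))

module TransducerMatrix {c ℓ} (F : Field c ℓ) {n : ℕ} {Y S : Set} {Q : ℕ}
  (encode : S → Fin Q) (decode : Fin Q → S) (decode-encode : ∀ s → decode (encode s) ≡ s)
  (δ : Y → S → Maybe (S × Maybe (Var n))) where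

  open Field F using (0#; 1#; *-identityˡ)
  open NCPoly F
  open Coefficients F {n}
  open Transducer δ

  label : Maybe (Var n) → Entry n
  label nothing  = const 1#
  label (just x) = var x

  cell : Maybe (S × Maybe (Var n)) → Fin Q → Entry n
  cell nothing        _ = const 0#
  cell (just (s , e)) j = if does (encode s ≟ j) then label e else const 0#

  transition : Y → Fin Q → Fin Q → Entry n
  transition y i = cell (δ y (decode i))

  -- Literally the product that substM substitutes for a monomial, so substM unfolds to it.
  wordMatrix : List Y → Mat Q (Var n)
  wordMatrix w = foldr (λ y M → (λ i j → entryₚ (transition y i j)) *M M) idM w

  outcome : Maybe (S × List (Var n)) → Fin Q → Poly
  outcome nothing        _ = []
  outcome (just (s , o)) j = if does (encode s ≟ j) then (1# , o) ∷ [] else []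

  outcome-guard : ∀ b s o → outcome (guard b (just (s , o))) (encode s) ≡ (if b then (1# , o) ∷ [] else [])
  outcome-guard true  s o rewrite dec-true (encode s ≟ encode s) refl = refl
  outcome-guard false s o = refl

  idM-outcome : ∀ s j → idM (encode s) j ≋ outcome (just (s , [])) j
  idM-outcome s j with encode s ≟ j
  ... | yes _ = ≋-refl
  ... | no  _ = ≋-refl

  label-outcome : ∀ e r j → (entryₚ (label e) *ₚ outcome r j) ≋ outcome (Maybe.map (prefix (fromMaybe e)) r) j
  label-outcome nothing  nothing        j = ≋-refl
  label-outcome (just x) nothing        j = ≋-refl
  label-outcome e        (just (s , o)) j with does (encode s ≟ j) | e
  ... | false | nothing = ≋-refl
  ... | false | just x  = ≋-refl
  ... | true  | nothing = term-cong o (*-identityˡ 1#)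
  ... | true  | just x  = term-cong (x ∷ o) (*-identityˡ 1#)

  wordMatrix-run : ∀ w s j → wordMatrix w (encode s) j ≋ outcome (run w s) j
  wordMatrix-run []      s j = idM-outcome s j
  wordMatrix-run (y ∷ w) s j = begin
    wordMatrix (y ∷ w) (encode s) j
      ≡⟨ cong (λ d → concat (map (step d) (allFin Q))) (cong (δ y) (decode-encode s)) ⟩
    concat (map (step (δ y s)) (allFin Q))
      ≡⟨ cong concat (map-tabulate id (step (δ y s))) ⟩
    concat (tabulate (step (δ y s)))
      ≈⟨ sum-step (δ y s) ⟩
    outcome (run (y ∷ w) s) j ∎
    where
    open ≋-Reasoning
    step : Maybe (S × Maybe (Var n)) → Fin Q → Poly
    step d k = entryₚ (cell d k) *ₚ wordMatrix w k j

    sum-step : ∀ d → concat (tabulate (step d)) ≋ outcome (continue d w) j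
    sum-step nothing         = sum-zero (step nothing) λ k → zero-*ₚ (wordMatrix w k j)
    sum-step (just (s′ , e)) = begin
      concat (tabulate (step (just (s′ , e))))           ≈⟨ sum-single (step (just (s′ , e))) (encode s′) off-diagonal ⟩
      step (just (s′ , e)) (encode s′)                   ≡⟨ cong (λ b → entryₚ (if b then label e else const 0#) *ₚ wordMatrix w (encode s′) j)
                                                                 (dec-true (encode s′ ≟ encode s′) refl) ⟩
      entryₚ (label e) *ₚ wordMatrix w (encode s′) j     ≈⟨ entry-*ₚ-cong (label e) (wordMatrix-run w s′ j) ⟩
      entryₚ (label e) *ₚ outcome (run w s′) j           ≈⟨ label-outcome e (run w s′) j ⟩
      outcome (continue (just (s′ , e)) w) j             ∎
      where
      off-diagonal : ∀ k → k ≢ encode s′ → step (just (s′ , e)) k ≋ []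
      off-diagonal k k≢s′ rewrite dec-false (encode s′ ≟ k) (k≢s′ ∘ sym) = zero-*ₚ (wordMatrix w k j)

module Reduction {c ℓ} (F : Field c ℓ) where

  open Field F using (1#)
  open NCPoly F
  open Coefficients F
  open Nat using (_*_)

  tuples-length : ∀ n k → All (λ is → length is ≡ k) (tuples n k)
  tuples-length n zero    = refl ∷ []
  tuples-length n (suc k) =
    All.concat⁺ (All.map⁺ {f = λ i → map (i ∷_) (tuples n k)} (All.tabulate⁺ {f = id} λ i →
      All.map⁺ {f = i ∷_} (All.map (cong suc) (tuples-length n k))))

  module _ (n : ℕ) where

    open PermutationCheck n
    open TransducerMatrix F encode decode decode-encode δ

    wordMatrix-rowWord : ∀ is → length is ≡ n →
                         wordMatrix (pow (rowWord is) (n * n)) zero (fromℕ (n * n)) ≋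
                         (if unique is then (1# , rowWord is) ∷ [] else [])
    wordMatrix-rowWord is len = begin
      wordMatrix (pow w (n * n)) zero (fromℕ (n * n))
        ≡⟨ cong (λ i → wordMatrix (pow w (n * n)) i (encode done)) (sym (encode-enter-0 n)) ⟩
      wordMatrix (pow w (n * n)) (encode (enter 0)) (encode done)
        ≈⟨ wordMatrix-run (pow w (n * n)) (enter 0) (encode done) ⟩
      outcome (run (pow w (n * n)) (enter 0)) (encode done)
        ≡⟨ cong (λ r → outcome r (encode done)) (run-accepts (RowsFrom-allFin is len)) ⟩
      outcome (guard (unique (cols w)) (just (done , w))) (encode done)
        ≡⟨ cong (λ cs → outcome (guard (unique cs) (just (done , w))) (encode done))
                (map-proj₂-zip (allFin n) is is≡allFin) ⟩
      outcome (guard (unique is) (just (done , w))) (encode done)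
        ≡⟨ outcome-guard (unique is) done w ⟩
      (if unique is then (1# , w) ∷ [] else []) ∎
      where
      open ≋-Reasoning
      w = rowWord is
      is≡allFin = trans len (sym (length-tabulate id))

    PER-≋-IDstar : ∀ T → All (λ is → length is ≡ n) T →
                   map (λ is → (1# , rowWord is)) (filter (Unique.unique? _≟_) T) ≋
                   substM (map (λ w → (1# , pow w (n * n))) (map rowWord T)) transition zero (fromℕ (n * n))
    PER-≋-IDstar []       []           = ≋-refl
    PER-≋-IDstar (is ∷ T) (len ∷ lens) = begin
      map (λ is → (1# , rowWord is)) (filter (Unique.unique? _≟_) (is ∷ T))
        ≡⟨ map-filter-∷ (λ is → (1# , rowWord is)) (Unique.unique? _≟_) is T ⟩
      (if unique is then (1# , rowWord is) ∷ [] else []) ++ map (λ is → (1# , rowWord is)) (filter (Unique.unique? _≟_) T)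
        ≈⟨ ++-cong (≋-sym (≋-trans (scaleₚ-identity _) (wordMatrix-rowWord is len))) (PER-≋-IDstar T lens) ⟩
      substM (map (λ w → (1# , pow w (n * n))) (map rowWord (is ∷ T))) transition zero (fromℕ (n * n)) ∎
      where open ≋-Reasoning

    witness : ∀ {m q} → m ≡ n → q ≡ n * n →
              Σ (Var m → Fin (suc q) → Fin (suc q) → Entry n) λ φ → PER n ≈ₚ substM (IDstar m) φ zero (fromℕ q)
    witness refl refl = transition , coeff-≈ (PER-≋-IDstar (tuples n n) (tuples-length n n))

evalℕPoly-x : ∀ n → evalℕPoly (0 ∷ 1 ∷ []) n ≡ n
evalℕPoly-x n = trans (cong (λ z → n Nat.* suc z) (NatP.*-zeroʳ n)) (NatP.*-identityʳ n)

evalℕPoly-x² : ∀ n → evalℕPoly (0 ∷ 0 ∷ 1 ∷ []) n ≡ n Nat.* n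
evalℕPoly-x² n = cong (n Nat.*_) (evalℕPoly-x n)

mainTheorem12 : {c ℓ : Level} (F : Field c ℓ) → NCPoly._≤abp_ F (NCPoly.PER F) (NCPoly.IDstar F)
mainTheorem12 F = (0 ∷ 1 ∷ []) , (0 ∷ 0 ∷ 1 ∷ []) , λ n → Reduction.witness F n (evalℕPoly-x n) (evalℕPoly-x² n)
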